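{- For every positive integer $n$ and every integer $j$ with $0\le j<n$, $$(2j+1)\binom{2j}{j}\sum_{k=j}^{n-1}(2k-j+1)\binom{k}{j}^2\equiv 0\pmod{n^2}.$$ -}

module Defs where

open import Data.Nat using (ℕ; zero; suc; _+_; _*_; _∸_; _^_; _≤?_)
open import Relation.Nullary using (yes; no)
open import Data.Nat.Combinatorics using (_C_)

-- rangeSum a b f = Σ_{k = a}^{b-1} f k  (empty if b ≤ a)
rangeSum : ℕ → ℕ → (ℕ → ℕ) → ℕ
rangeSum a zero    f = 0
rangeSum a (suc b) f with a ≤? b
... | yes _ = rangeSum a b f + f b
... | no  _ = rangeSum a b f

-- the summand (2k - j + 1) * (k choose j)^2 ; natural subtraction is exact for k ≥ j
summand : ℕ → ℕ → ℕ
summand j k = (2 * k ∸ j + 1) * (k C j) ^ 2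

lhs : ℕ → ℕ → ℕ
lhs n j = (2 * j + 1) * ((2 * j) C j) * rangeSum j n (summand j)

-- Writing k = j + a, the absorption identity k·C(k-1, j) = a·C(k, j) turns the
-- summand into a telescoping difference:
--   (j+1)(2k-j+1)·C(k,j)² = ((k+1)·C(k,j))² − (k·C(k-1,j))²,
-- since (k+1)² − a² = (j+1)(j+2a+1).  Hence (j+1) times the sum is (n·C(n-1,j))²,
-- and the remaining factor C(2j,j) is divisible by j+1 (Catalan numbers).
module Submission where

open import Defs
open import Data.Nat using (ℕ; suc; _<_; _*_)
open import Data.Nat.Divisibility using (_∣_)

open import Data.Nat using (zero; _+_; _∸_; _^_; _≤_; _≤?_; z≤n; s≤s)
open import Data.Nat.Properties
open import Data.Nat.Combinatorics using (_C_; k>n⇒nCk≡0; nC1≡n; nCk+nC[k+1]≡[n+1]C[k+1])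
open import Data.Nat.Divisibility using (divides; *-pres-∣; m∣m*n; ∣m⇒∣m*n; ∣n⇒∣m*n)
open import Data.Product using (_,_)
open import Data.Sum using (inj₁; inj₂)
open import Relation.Nullary using (yes; no)
open import Relation.Nullary.Negation using (contradiction)
open import Relation.Binary.PropositionalEquality
open import Data.Nat.Tactic.RingSolver using (solve-∀)
open ≡-Reasoning

rangeSum-empty : ∀ a b f → b ≤ a → rangeSum a b f ≡ 0
rangeSum-empty a zero    f _ = refl
rangeSum-empty a (suc b) f b<a with a ≤? b
... | yes a≤b = contradiction b<a (<⇒≱ (s≤s a≤b))
... | no  _   = rangeSum-empty a b f (<⇒≤ b<a)

rangeSum-suc : ∀ a b f → a ≤ b → rangeSum a (suc b) f ≡ rangeSum a b f + f b
rangeSum-suc a b f a≤b with a ≤? b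
... | yes _   = refl
... | no  a≰b = contradiction a≤b a≰b

rangeSum-telescope : ∀ a c (f G : ℕ → ℕ) → (∀ k → a ≤ k → G k + c * f k ≡ G (suc k)) →
                     ∀ b → a ≤ b → c * rangeSum a b f + G a ≡ G b
rangeSum-telescope a c f G step b a≤b with m≤n⇒m<n∨m≡n a≤b
... | inj₂ refl = begin
  c * rangeSum a a f + G a  ≡⟨ cong (λ s → c * s + G a) (rangeSum-empty a a f ≤-refl) ⟩
  c * 0 + G a               ≡⟨ cong (_+ G a) (*-zeroʳ c) ⟩
  G a                       ∎
rangeSum-telescope a c f G step (suc b) _ | inj₁ (s≤s a≤b) = begin
  c * rangeSum a (suc b) f + G a    ≡⟨ cong (λ s → c * s + G a) (rangeSum-suc a b f a≤b) ⟩
  c * (rangeSum a b f + f b) + G a  ≡⟨ shuffle c (rangeSum a b f) (f b) (G a) ⟩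
  (c * rangeSum a b f + G a) + c * f b
    ≡⟨ cong (_+ c * f b) (rangeSum-telescope a c f G step b a≤b) ⟩
  G b + c * f b                     ≡⟨ step b a≤b ⟩
  G (suc b)                         ∎
  where
  shuffle : ∀ c s x g → c * (s + x) + g ≡ (c * s + g) + c * x
  shuffle = solve-∀

[1+k]*[1+n]C[1+k]≡[1+n]*nCk : ∀ n k → suc k * (suc n C suc k) ≡ suc n * (n C k)
[1+k]*[1+n]C[1+k]≡[1+n]*nCk n zero =
  trans (*-identityˡ _) (trans (nC1≡n (suc n)) (sym (*-identityʳ (suc n))))
[1+k]*[1+n]C[1+k]≡[1+n]*nCk zero (suc k) =
  trans (cong (suc (suc k) *_) (k>n⇒nCk≡0 {1} {suc (suc k)} (s≤s (s≤s z≤n)))) (*-zeroʳ (suc (suc k)))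
[1+k]*[1+n]C[1+k]≡[1+n]*nCk (suc n) (suc k) = begin
  suc (suc k) * (suc (suc n) C suc (suc k))
    ≡⟨ cong (suc (suc k) *_) (sym (pascal (suc n) (suc k))) ⟩
  suc (suc k) * (X + Y)                      ≡⟨ expand (suc k) X Y ⟩
  suc k * X + X + suc (suc k) * Y
    ≡⟨ cong₂ (λ u v → u + X + v) (absorb k) (absorb (suc k)) ⟩
  suc n * (n C k) + X + suc n * (n C suc k)  ≡⟨ collect (suc n) (n C k) X (n C suc k) ⟩
  suc n * (n C k + n C suc k) + X            ≡⟨ cong (λ z → suc n * z + X) (pascal n k) ⟩
  suc n * X + X                              ≡⟨ +-comm (suc n * X) X ⟩
  suc (suc n) * X                            ∎
  where
  pascal = nCk+nC[k+1]≡[n+1]C[k+1]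
  absorb = [1+k]*[1+n]C[1+k]≡[1+n]*nCk n
  X = suc n C suc k
  Y = suc n C suc (suc k)
  expand : ∀ k x y → suc k * (x + y) ≡ k * x + x + suc k * y
  expand = solve-∀
  collect : ∀ m u x v → m * u + x + m * v ≡ m * (u + v) + x
  collect = solve-∀

n*[n∸1]Ck≡[n∸k]*nCk : ∀ {n k} → k ≤ n → n * ((n ∸ 1) C k) ≡ (n ∸ k) * (n C k)
n*[n∸1]Ck≡[n∸k]*nCk {zero}  z≤n = refl
n*[n∸1]Ck≡[n∸k]*nCk {suc n} {zero}  _ = refl
n*[n∸1]Ck≡[n∸k]*nCk {suc n} {suc k} (s≤s k≤n) = +-cancelˡ-≡ (suc n * (n C k)) _ _ (begin
  suc n * (n C k) + suc n * (n C suc k)  ≡⟨ sym (*-distribˡ-+ (suc n) (n C k) (n C suc k)) ⟩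
  suc n * (n C k + n C suc k)            ≡⟨ cong (suc n *_) (nCk+nC[k+1]≡[n+1]C[k+1] n k) ⟩
  suc n * c                              ≡⟨ cong (_* c) (sym (m+[n∸m]≡n (s≤s k≤n))) ⟩
  (suc k + (n ∸ k)) * c                  ≡⟨ *-distribʳ-+ c (suc k) (n ∸ k) ⟩
  suc k * c + (n ∸ k) * c                ≡⟨ cong (_+ (n ∸ k) * c) ([1+k]*[1+n]C[1+k]≡[1+n]*nCk n k) ⟩
  suc n * (n C k) + (n ∸ k) * c          ∎)
  where
  c = suc n C suc k

closedForm : ℕ → ℕ → ℕ
closedForm j n = (n * ((n ∸ 1) C j)) ^ 2

closedForm-diagonal : ∀ j → closedForm j j ≡ 0
closedForm-diagonal j =
  cong (_^ 2) (trans (n*[n∸1]Ck≡[n∸k]*nCk {j} ≤-refl) (cong (_* (j C j)) (n∸n≡0 j)))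

closedForm-step : ∀ j k → j ≤ k →
  closedForm j k + suc j * summand j k ≡ closedForm j (suc k)
closedForm-step j k j≤k with m≤n⇒∃[o]m+o≡n j≤k
... | a , refl = begin
  (k * ((k ∸ 1) C j)) ^ 2 + suc j * ((2 * k ∸ j + 1) * c ^ 2)
    ≡⟨ cong₂ (λ x y → x ^ 2 + suc j * ((y + 1) * c ^ 2)) lower-factor weight ⟩
  (a * c) ^ 2 + suc j * ((j + 2 * a + 1) * c ^ 2)  ≡⟨ square-step j a c ⟩
  (suc k * c) ^ 2                                  ∎
  where
  c = k C j
  lower-factor : k * ((k ∸ 1) C j) ≡ a * c
  lower-factor = trans (n*[n∸1]Ck≡[n∸k]*nCk j≤k) (cong (_* c) (m+n∸m≡n j a))
  weight : 2 * k ∸ j ≡ j + 2 * a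
  weight = trans (cong (_∸ j) (double j a)) (m+n∸m≡n j (j + 2 * a))
    where
    double : ∀ j a → 2 * (j + a) ≡ j + (j + 2 * a)
    double = solve-∀
  -- squares written out, as the ring solver does not accept _^_ here
  square-step : ∀ j a c → (a * c) * (a * c * 1) + suc j * ((j + 2 * a + 1) * (c * (c * 1)))
                        ≡ (suc (j + a) * c) * (suc (j + a) * c * 1)
  square-step = solve-∀

[1+j]*sum≡closedForm : ∀ j n → j ≤ n → suc j * rangeSum j n (summand j) ≡ closedForm j n
[1+j]*sum≡closedForm j n j≤n = begin
  suc j * S                   ≡⟨ sym (+-identityʳ (suc j * S)) ⟩
  suc j * S + 0               ≡⟨ cong (suc j * S +_) (sym (closedForm-diagonal j)) ⟩
  suc j * S + closedForm j j
    ≡⟨ rangeSum-telescope j (suc j) (summand j) (closedForm j) (closedForm-step j) n j≤n ⟩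
  closedForm j n              ∎
  where
  S = rangeSum j n (summand j)

[1+n]∣[2n]Cn : ∀ n → suc n ∣ (2 * n) C n
[1+n]∣[2n]Cn n = divides (c ∸ d) (sym (begin
  (c ∸ d) * suc n          ≡⟨ *-comm (c ∸ d) (suc n) ⟩
  suc n * (c ∸ d)          ≡⟨ *-distribˡ-∸ (suc n) c d ⟩
  suc n * c ∸ suc n * d    ≡⟨ cong (suc n * c ∸_) [1+n]*d≡n*c ⟩
  c + n * c ∸ n * c        ≡⟨ m+n∸n≡m c (n * c) ⟩
  c                        ∎))
  where
  c = (2 * n) C n
  d = (2 * n) C suc n
  [1+n]*[c+d]≡[1+2n]*c : suc n * (c + d) ≡ suc (2 * n) * c
  [1+n]*[c+d]≡[1+2n]*c = trans (cong (suc n *_) (nCk+nC[k+1]≡[n+1]C[k+1] (2 * n) n))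
                               ([1+k]*[1+n]C[1+k]≡[1+n]*nCk (2 * n) n)
  [1+n]*d≡n*c : suc n * d ≡ n * c
  [1+n]*d≡n*c = +-cancelˡ-≡ (suc n * c) _ _ (begin
    suc n * c + suc n * d  ≡⟨ sym (*-distribˡ-+ (suc n) c d) ⟩
    suc n * (c + d)        ≡⟨ [1+n]*[c+d]≡[1+2n]*c ⟩
    suc (2 * n) * c        ≡⟨ split n c ⟩
    suc n * c + n * c      ∎)
    where
    split : ∀ n c → suc (2 * n) * c ≡ suc n * c + n * c
    split = solve-∀

m∣n⇒m*m∣n^2 : ∀ {m n} → m ∣ n → m * m ∣ n ^ 2
m∣n⇒m*m∣n^2 m∣n = *-pres-∣ m∣n (∣m⇒∣m*n 1 m∣n)

lemma5p3 : (n j : ℕ) → 0 < n → j < n → (n * n) ∣ lhs n j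
lemma5p3 n j _ j<n with [1+n]∣[2n]Cn j
... | divides q [2j]Cj≡q*[1+j] =
  subst (n * n ∣_) (sym lhs≡) (∣n⇒∣m*n ((2 * j + 1) * q) n*n∣[1+j]*S)
  where
  S = rangeSum j n (summand j)
  n*n∣[1+j]*S : n * n ∣ suc j * S
  n*n∣[1+j]*S = subst (n * n ∣_) (sym ([1+j]*sum≡closedForm j n (<⇒≤ j<n)))
                      (m∣n⇒m*m∣n^2 (m∣m*n {n} ((n ∸ 1) C j)))
  lhs≡ : lhs n j ≡ (2 * j + 1) * q * (suc j * S)
  lhs≡ = begin
    (2 * j + 1) * ((2 * j) C j) * S  ≡⟨ cong (λ x → (2 * j + 1) * x * S) [2j]Cj≡q*[1+j] ⟩
    (2 * j + 1) * (q * suc j) * S    ≡⟨ regroup (2 * j + 1) q (suc j) S ⟩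
    (2 * j + 1) * q * (suc j * S)    ∎
    where
    regroup : ∀ x q y s → x * (q * y) * s ≡ x * q * (y * s)
    regroup = solve-∀
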